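{- Let $X=\{1,\dots,n\}$, $\boldsymbol{\alpha}$ a sequence of nonnegative integers and $U\subseteq X\times X$. If $\operatorname{maj}'_U$ and $\operatorname{inv}'_U$ are equidistributed on $\mathcal{R}(\boldsymbol{\alpha})$, then there exists a maximal chain word $w=w_kw_{k-1}\cdots w_1\in\mathcal{R}(\boldsymbol{\alpha})$ (for $U$), with each $w_j$ a descending chain, such that for every $j$, writing $w_j=y_1y_2\cdots y_\ell$, we have $(y_r,y_s)\in U$ for all $1\le r<s\le\ell$.
   Context: $\mathcal{R}(\boldsymbol{\alpha})$ is the set of words with exactly $\alpha_i$ occurrences of $i$. $\operatorname{inv}'_U w=\#\{(i,j):i<j,\ (x_i,x_j)\in U\}$, $\operatorname{maj}'_U w=\sum i$ over $1\le i\le m-1$ with $(x_i,x_{i+1})\in U$ for $w=x_1\cdots x_m$; equidistributed means equal generating functions $\sum_w q^{(\cdot)}$ over $\mathcal{R}(\boldsymbol{\alpha})$. Let $(\boldsymbol{\alpha},U)$ be the directed graph whose vertices are the elements of the multiset $\{1^{\alpha_1},\dots,n^{\alpha_n}\}$ (each copy a separate vertex), with an edge $u\to v$ between distinct vertices whenever (value of $u$, value of $v$) $\in U$. A descending chain is a sequence of distinct vertices $y_1\to\cdots\to y_\ell$. A maximal chain word is obtained by choosing a descending chain $w_1$ of maximum length in $(\boldsymbol{\alpha},U)$, deleting its vertices, choosing a descending chain $w_2$ of maximum length among the remaining vertices, etc., until none remain, and concatenating $w=w_kw_{k-1}\cdots w_1$. -}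

module Defs where

open import Data.Nat using (ℕ; zero; suc; _+_; _≤_; _<_)
open import Data.Fin using (Fin)
open import Data.Fin.Properties using () renaming (_≟_ to _≟F_)
open import Data.Bool using (Bool; true; false; if_then_else_)
open import Data.List using (List; []; _∷_; length; filter; map; concat; reverse; concatMap; allFin)
open import Data.List.Membership.Propositional using (_∈_)
open import Data.List.Relation.Unary.All using (All)
open import Data.List.Relation.Unary.AllPairs using (AllPairs)
open import Data.List.Relation.Unary.Linked using (Linked)
open import Data.List.Relation.Unary.Unique.Propositional using (Unique)
open import Data.List.Relation.Binary.Permutation.Propositional using (_↭_)
open import Data.Product using (Σ; _×_; _,_; proj₁)
open import Function.Bundles using (_↔_)
open import Relation.Binary.PropositionalEquality using (_≡_; _≢_)

Rel : ℕ → Set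
Rel n = Fin n → Fin n → Bool

occ : ∀ {n} → Fin n → List (Fin n) → ℕ
occ i w = length (filter (_≟F i) w)

InR : ∀ {n} → (Fin n → ℕ) → List (Fin n) → Set
InR α w = ∀ i → occ i w ≡ α i

inv′ : ∀ {n} → Rel n → List (Fin n) → ℕ
inv′ U []       = 0
inv′ U (x ∷ xs) = length (filter (λ y → U x y Data.Bool.≟ true) xs) + inv′ U xs

-- maj'_U w = Σ { i : 1 ≤ i ≤ m-1, (x_i,x_{i+1}) ∈ U }   (positions 1-based)
majFrom : ∀ {n} → Rel n → ℕ → List (Fin n) → ℕ
majFrom U k []           = 0
majFrom U k (x ∷ [])     = 0
majFrom U k (x ∷ y ∷ ys) = (if U x y then k else 0) + majFrom U (suc k) (y ∷ ys)

maj′ : ∀ {n} → Rel n → List (Fin n) → ℕ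
maj′ U = majFrom U 1

-- Equidistribution on R(α): Σ_w q^{maj' w} = Σ_w q^{inv' w}, i.e. for every k the
-- (finite) sets {w ∈ R(α) | maj' w = k} and {w ∈ R(α) | inv' w = k} have the same
-- cardinality, expressed as the existence of a bijection.
Equidistributed : ∀ {n} → (Fin n → ℕ) → Rel n → Set
Equidistributed {n} α U =
  ∀ k → Σ (List (Fin n)) (λ w → InR α w × maj′ U w ≡ k)
      ↔ Σ (List (Fin n)) (λ w → InR α w × inv′ U w ≡ k)

-- Vertices of the graph (α,U): the copies (i , c), c < α i, of each letter i.
Vertex : ∀ {n} → (Fin n → ℕ) → Set
Vertex {n} α = Σ (Fin n) (λ i → Fin (α i))

val : ∀ {n} {α : Fin n → ℕ} → Vertex α → Fin n
val = proj₁

allVertices : ∀ {n} (α : Fin n → ℕ) → List (Vertex α)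
allVertices {n} α = concatMap (λ i → map (λ c → (i , c)) (allFin (α i))) (allFin n)

Edge : ∀ {n} {α : Fin n → ℕ} → Rel n → Vertex α → Vertex α → Set
Edge U u v = u ≢ v × U (val u) (val v) ≡ true

Chain : ∀ {n} {α : Fin n → ℕ} → Rel n → List (Vertex α) → Set
Chain U c = Unique c × Linked (Edge U) c

data MaxChainDecomp {n} {α : Fin n → ℕ} (U : Rel n) :
       List (Vertex α) → List (List (Vertex α)) → Set where
  done : MaxChainDecomp U [] []
  step : ∀ {S S′ c cs} →
         0 < length c →
         Chain U c →
         (∀ c′ → Chain U c′ → All (_∈ S) c′ → length c′ ≤ length c) →
         S ↭ (c Data.List.++ S′) →
         MaxChainDecomp U S′ cs →
         MaxChainDecomp U S (c ∷ cs)

-- the word w = w_k w_{k-1} ⋯ w_1 (as letters) from the chains w₁ , … , w_k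
chainWord : ∀ {n} {α : Fin n → ℕ} → List (List (Vertex α)) → List (Fin n)
chainWord cs = map val (concat (reverse cs))

TransitiveChain : ∀ {n} {α : Fin n → ℕ} → Rel n → List (Vertex α) → Set
TransitiveChain U c = AllPairs (λ u v → U (val u) (val v) ≡ true) c

-- Let w₁, …, w_k be a maximal chain decomposition, ℓⱼ = |wⱼ| and Nⱼ the number of
-- vertices left after deleting w₁, …, wⱼ. In the chain word wⱼ occupies the positions
-- Nⱼ + 1, …, Nⱼ + ℓⱼ and every descent inside it counts, so
-- maj′ ≥ B := Σⱼ (ℓⱼ(ℓⱼ − 1)/2 + (ℓⱼ − 1) Nⱼ).
-- Conversely every arrangement of the vertices has inv′ ≤ B: split off the vertices of
-- w₁; pairs among them contribute at most ℓ₁(ℓ₁ − 1)/2, and a vertex u outside w₁ is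
-- related in the right direction to at most ℓ₁ − 1 of them, for otherwise u is comparable
-- with all of w₁ and could be inserted into it, giving a longer chain.
-- Equidistribution yields an arrangement with inv′ = maj′ ≥ B, so all these bounds are
-- tight; in particular the vertices of w₁, read in the order of that arrangement, form a
-- transitive chain of maximum length, and the argument recurses on the rest.
module Submission where

open import Defs
open import Data.Bool using (true; if_then_else_)
import Data.Bool as Bool
open import Data.Fin using (Fin)
open import Data.Fin.Properties using () renaming (_≟_ to _≟F_)
open import Data.List
  using (List; []; _∷_; [_]; _++_; length; filter; map; concat; concatMap; reverse; allFin)
open import Data.List.Extrema.Nat using (argmax; argmax-all; f[⊥]≤f[argmax]; f[xs]≤f[argmax])
open import Data.List.Membership.Propositional using (_∈_; _∉_; find)
open import Data.List.Membership.Propositional.Properties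
  using (∈-∃++; ∈-++⁺ˡ; ∈-++⁺ʳ; ∈-++⁻; ∈-filter⁺; ∈-filter⁻; ∈-map⁺; ∈-map⁻;
         ∈-concatMap⁺; ∈-concatMap⁻; ∈-allFin)
open import Data.List.Membership.Propositional.Properties.WithK using (unique∧set⇒bag)
open import Data.List.Properties
  using (length-filter; length-++; length-map; length-tabulate; filter-accept; filter-complete;
         filter-all; filter-none; filter-++; concat-++; map-++; unfold-reverse; ++-identityʳ;
         partition-defn)
open import Data.List.Relation.Binary.BagAndSetEquality using (∼bag⇒↭)
open import Data.List.Relation.Binary.Permutation.Propositional
  using (_↭_; ↭-refl; ↭-reflexive; ↭-sym; ↭-trans; prep; swap; ↭⇒↭ₛ; ↭ₛ⇒↭)
open import Data.List.Relation.Binary.Permutation.Propositional.Properties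
  using (filter-↭; shift; ∈-resp-↭; All-resp-↭; ↭-length; ↭-empty-inv; ++⁺ˡ; ++⁺ʳ; ++-comm;
         ↭-map-inv)
import Data.List.Relation.Binary.Permutation.Setoid.Properties as PermutationSetoid
open import Data.List.Relation.Binary.Subset.Propositional using (_⊆_)
open import Data.List.Relation.Unary.All as All using (All; []; _∷_)
open import Data.List.Relation.Unary.All.Properties using (all-filter; ¬Any⇒All¬)
import Data.List.Relation.Unary.All.Properties as AllProperties
open import Data.List.Relation.Unary.AllPairs as AllPairs using (AllPairs; []; _∷_)
import Data.List.Relation.Unary.AllPairs.Properties as AllPairsProperties
open import Data.List.Relation.Unary.Any as Any using (here; there)
open import Data.List.Relation.Unary.Linked as Linked using (Linked; []; [-]; _∷_; linked?)
open import Data.List.Relation.Unary.Linked.Properties using (AllPairs⇒Linked)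
import Data.List.Relation.Unary.Linked.Properties as LinkedProperties
open import Data.List.Relation.Unary.Unique.Propositional using (Unique)
import Data.List.Relation.Unary.Unique.Propositional.Properties as UniqueProperties
open import Data.Nat using (ℕ; zero; suc; pred; _+_; _*_; _≤_; _<_; z≤n; s≤s; s≤s⁻¹; _<?_)
open import Data.Nat.Properties
  using (+-suc; +-assoc; +-identityʳ; +-comm; *-suc; ≤-refl; ≤-reflexive; ≤-trans; ≤-antisym;
         ≮⇒≥; <-irrefl; +-mono-≤; +-monoʳ-≤; +-monoˡ-≤; +-cancelˡ-≤; +-cancelʳ-≤; m≤n+m;
         suc-injective; 0≢1+n; 1+n≢0; module ≤-Reasoning)
open import Data.Nat.Tactic.RingSolver using (solve-∀)
open import Data.Product using (Σ; Σ-syntax; _×_; _,_; proj₁; proj₂)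
open import Data.Product.Properties using (≡-dec)
open import Data.Sum using (_⊎_; inj₁; inj₂; [_,_]′)
open import Function.Base using (_∘_; id)
open import Function.Bundles using (Inverse; mk⇔)
open import Relation.Binary.Definitions using (DecidableEquality) renaming (Decidable to Decidable₂)
open import Relation.Binary.PropositionalEquality
  using (_≡_; _≢_; refl; sym; trans; cong; cong₂; subst; setoid; module ≡-Reasoning)
open import Relation.Nullary using (¬_; yes; no; contradiction)
open import Relation.Nullary.Decidable using (_×-dec_; ¬?)
open import Relation.Unary using (Pred; Decidable)
open import Relation.Unary.Properties using (∁?)

+-tight : ∀ {a b A B} → a ≤ A → b ≤ B → A + B ≤ a + b → A ≤ a × B ≤ b
+-tight {a} {b} {A} {B} a≤A b≤B sum≤ =
  +-cancelʳ-≤ B A a (≤-trans sum≤ (+-monoʳ-≤ a b≤B)) ,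
  +-cancelˡ-≤ A B b (≤-trans sum≤ (+-monoˡ-≤ b a≤A))

m+n≤o*n⇒m≤pred[o]*n : ∀ {m n o} → 0 < o → m + n ≤ o * n → m ≤ pred o * n
m+n≤o*n⇒m≤pred[o]*n {m} {n} {suc o} _ h =
  +-cancelʳ-≤ n m (o * n) (subst (m + n ≤_) (+-comm n (o * n)) h)

pairs : ℕ → ℕ
pairs zero    = 0
pairs (suc k) = k + pairs k

count : ∀ {A : Set} {p} {P : Pred A p} → Decidable P → List A → ℕ
count P? xs = length (filter P? xs)

module _ {A : Set} where

  module _ {p} {P : Pred A p} (P? : Decidable P) where

    count-resp-↭ : ∀ {xs ys} → xs ↭ ys → count P? xs ≡ count P? ys
    count-resp-↭ p = ↭-length (filter-↭ P? p)

    count-map : ∀ {B : Set} (f : B → A) xs → count P? (map f xs) ≡ count (λ y → P? (f y)) xs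
    count-map f [] = refl
    count-map f (x ∷ xs) with P? (f x)
    ... | yes _ = cong suc (count-map f xs)
    ... | no _  = count-map f xs

    length≤count⇒All : ∀ xs → length xs ≤ count P? xs → All P xs
    length≤count⇒All xs h =
      subst (All P) (filter-complete P? (≤-antisym (length-filter P? xs) h)) (all-filter P? xs)

    filter-partition-↭ : ∀ xs → xs ↭ filter P? xs ++ filter (∁? P?) xs
    filter-partition-↭ xs =
      subst (λ (ys , zs) → xs ↭ ys ++ zs) (partition-defn P? xs)
            (↭ₛ⇒↭ (PermutationSetoid.partition-↭ (setoid A) P? xs))

    module _ {q} {Q : Pred A q} (Q? : Decidable Q) where

      count-partition : ∀ xs →
        count Q? xs ≡ count Q? (filter P? xs) + count Q? (filter (∁? P?) xs)
      count-partition [] = refl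
      count-partition (x ∷ xs) with P? x
      ... | yes _ with Q? x
      ...   | yes _ = cong suc (count-partition xs)
      ...   | no _  = count-partition xs
      count-partition (x ∷ xs) | no _ with Q? x
      ...   | yes _ = trans (cong suc (count-partition xs)) (sym (+-suc _ _))
      ...   | no _  = count-partition xs

  Unique-resp-↭ : ∀ {xs ys : List A} → xs ↭ ys → Unique xs → Unique ys
  Unique-resp-↭ p = PermutationSetoid.Unique-resp-↭ (setoid A) (↭⇒↭ₛ p)

  Unique-++⇒disjoint : ∀ xs {ys} {v : A} → Unique (xs ++ ys) → v ∈ xs → v ∉ ys
  Unique-++⇒disjoint (x ∷ xs) (x∉ ∷ _) (here refl) v∈ys = All.lookup x∉ (∈-++⁺ʳ xs v∈ys) refl
  Unique-++⇒disjoint (x ∷ xs) (_ ∷ u) (there v∈xs) v∈ys = Unique-++⇒disjoint xs u v∈xs v∈ys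

  unique-⊆⇒length≤ : ∀ {xs ys : List A} → Unique xs → xs ⊆ ys → length xs ≤ length ys
  unique-⊆⇒length≤ {[]} _ _ = z≤n
  unique-⊆⇒length≤ {x ∷ xs} (x∉xs ∷ u) xs⊆ys with ∈-∃++ (xs⊆ys (here refl))
  ... | as , bs , refl =
    subst (suc (length xs) ≤_) (sym (↭-length (shift x as bs)))
          (s≤s (unique-⊆⇒length≤ u xs⊆as++bs))
    where
    xs⊆as++bs : xs ⊆ as ++ bs
    xs⊆as++bs v∈xs with ∈-resp-↭ (shift x as bs) (xs⊆ys (there v∈xs))
    ... | here refl = contradiction refl (All.lookup x∉xs v∈xs)
    ... | there v∈  = v∈

  unique-⊆⊇⇒↭ : ∀ {xs ys : List A} → Unique xs → Unique ys → xs ⊆ ys → ys ⊆ xs → xs ↭ ys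
  unique-⊆⊇⇒↭ ux uy xs⊆ys ys⊆xs = ∼bag⇒↭ (unique∧set⇒bag ux uy (mk⇔ xs⊆ys ys⊆xs))

  module _ (_≟_ : DecidableEquality A) where

    open import Data.List.Membership.DecPropositional _≟_ using (_∈?_)

    filter-∈-↭ : ∀ {xs c} → Unique xs → Unique c → c ⊆ xs → filter (_∈? c) xs ↭ c
    filter-∈-↭ {xs} {c} ux uc c⊆xs =
      unique-⊆⊇⇒↭ (UniqueProperties.filter⁺ (_∈? c) ux) uc
        (proj₂ ∘ ∈-filter⁻ (_∈? c) {xs = xs}) (λ v∈c → ∈-filter⁺ (_∈? c) (c⊆xs v∈c) v∈c)

    count-self-∷ : ∀ x xs → count (_≟ x) (x ∷ xs) ≡ suc (count (_≟ x) xs)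
    count-self-∷ x xs = cong length (filter-accept (_≟ x) refl)

    count-∷-injective : ∀ x {xs ys} a →
      count (_≟ a) (x ∷ xs) ≡ count (_≟ a) (x ∷ ys) → count (_≟ a) xs ≡ count (_≟ a) ys
    count-∷-injective x a eq with x ≟ a
    ... | yes _ = suc-injective eq
    ... | no _  = eq

    occurrences-≡⇒↭ : ∀ xs {ys} → (∀ a → count (_≟ a) xs ≡ count (_≟ a) ys) → xs ↭ ys
    occurrences-≡⇒↭ [] {[]} _ = ↭-refl
    occurrences-≡⇒↭ [] {y ∷ ys} eq = contradiction (trans (eq y) (count-self-∷ y ys)) 0≢1+n
    occurrences-≡⇒↭ (x ∷ xs) {ys} eq with x ∈? ys
    ... | no x∉ys = contradiction (trans (sym (count-self-∷ x xs)) (trans (eq x) no-x-in-ys)) 1+n≢0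
      where
      no-x-in-ys : count (_≟ x) ys ≡ 0
      no-x-in-ys = cong length (filter-none (_≟ x) (All.map (_∘ sym) (¬Any⇒All¬ ys x∉ys)))
    ... | yes x∈ys with ∈-∃++ x∈ys
    ...   | as , bs , refl = ↭-trans (prep x (occurrences-≡⇒↭ xs eq′)) (↭-sym (shift x as bs))
      where
      eq′ : ∀ a → count (_≟ a) xs ≡ count (_≟ a) (as ++ bs)
      eq′ a = count-∷-injective x a (trans (eq a) (count-resp-↭ (_≟ a) (shift x as bs)))

module Chains {A : Set} (_≟_ : DecidableEquality A) {R : A → A → Set} (R? : Decidable₂ R) where

  open import Data.List.Membership.DecPropositional _≟_ using (_∈?_)
  open import Data.List.Relation.Unary.Unique.DecPropositional _≟_ using (unique?)

  _↝_ : A → A → Set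
  u ↝ v = u ≢ v × R u v

  IsChain : List A → Set
  IsChain c = Unique c × Linked _↝_ c

  Longest : List A → List A → Set
  Longest S c = ∀ c′ → IsChain c′ → All (_∈ S) c′ → length c′ ≤ length c

  Comparable : A → A → Set
  Comparable u v = R u v ⊎ R v u

  insert : A → List A → List A
  insert u [] = [ u ]
  insert u (v ∷ c) with R? u v
  ... | yes _ = u ∷ v ∷ c
  ... | no _  = v ∷ insert u c

  insert-↭ : ∀ u c → insert u c ↭ u ∷ c
  insert-↭ u [] = ↭-refl
  insert-↭ u (v ∷ c) with R? u v
  ... | yes _ = ↭-refl
  ... | no _  = ↭-trans (prep v (insert-↭ u c)) (swap v u ↭-refl)

  private
    flipped : ∀ {u v} → ¬ R u v → Comparable u v → R v u
    flipped ¬uv = [ (λ uv → contradiction uv ¬uv) , id ]′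

  insert-linked-after : ∀ {y u} c → y ↝ u → u ∉ c → All (Comparable u) c →
                        Linked _↝_ (y ∷ c) → Linked _↝_ (y ∷ insert u c)
  insert-linked-after [] yu _ _ _ = yu ∷ [-]
  insert-linked-after {u = u} (v ∷ c) yu u∉ (u~v ∷ u~c) (yv ∷ lk) with R? u v
  ... | yes uv  = yu ∷ ((u∉ ∘ here , uv) ∷ lk)
  ... | no ¬uv =
    yv ∷ insert-linked-after c ((u∉ ∘ here ∘ sym) , flipped ¬uv u~v) (u∉ ∘ there) u~c lk

  insert-linked : ∀ {u} c → u ∉ c → All (Comparable u) c →
                  Linked _↝_ c → Linked _↝_ (insert u c)
  insert-linked [] _ _ _ = [-]
  insert-linked {u} (v ∷ c) u∉ (u~v ∷ u~c) lk with R? u v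
  ... | yes uv  = (u∉ ∘ here , uv) ∷ lk
  ... | no ¬uv =
    insert-linked-after c ((u∉ ∘ here ∘ sym) , flipped ¬uv u~v) (u∉ ∘ there) u~c lk

  insert-chain : ∀ {u c} → IsChain c → u ∉ c → All (Comparable u) c → IsChain (insert u c)
  insert-chain {u} {c} (uc , lc) u∉ u~c =
    Unique-resp-↭ (↭-sym (insert-↭ u c)) (¬Any⇒All¬ c u∉ ∷ uc) , insert-linked c u∉ u~c lc

  inversions : List A → ℕ
  inversions []       = 0
  inversions (x ∷ xs) = count (R? x) xs + inversions xs

  inversions≤pairs : ∀ xs → inversions xs ≤ pairs (length xs)
  inversions≤pairs []       = z≤n
  inversions≤pairs (x ∷ xs) = +-mono-≤ (length-filter (R? x) xs) (inversions≤pairs xs)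

  pairs≤inversions⇒AllPairs : ∀ xs → pairs (length xs) ≤ inversions xs → AllPairs R xs
  pairs≤inversions⇒AllPairs []       _ = []
  pairs≤inversions⇒AllPairs (x ∷ xs) h =
    let (h-head , h-tail) = +-tight (length-filter (R? x) xs) (inversions≤pairs xs) h
    in length≤count⇒All (R? x) xs h-head ∷ pairs≤inversions⇒AllPairs xs h-tail

  module _ {p} {P : Pred A p} (P? : Decidable P) where

    cross : List A → ℕ
    cross [] = 0
    cross (x ∷ xs) with P? x
    ... | yes _ = count (R? x) (filter (∁? P?) xs) + cross xs
    ... | no _  = count (R? x) (filter P? xs) + cross xs

    private
      module Summands (x : A) (xs : List A) where
        a = count (R? x) (filter P? xs)
        b = count (R? x) (filter (∁? P?) xs)
        i = inversions (filter P? xs)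
        j = inversions (filter (∁? P?) xs)
        k = cross xs

    inversions-split : ∀ xs →
      inversions xs ≡ inversions (filter (∁? P?) xs) + (inversions (filter P? xs) + cross xs)
    inversions-split [] = refl
    inversions-split (x ∷ xs) with P? x
    ... | yes _ = trans (cong₂ _+_ (count-partition P? (R? x) xs) (inversions-split xs))
                        (regroup a b i j k)
      where
      open Summands x xs
      regroup : ∀ a b i j k → (a + b) + (j + (i + k)) ≡ j + ((a + i) + (b + k))
      regroup = solve-∀
    ... | no _  = trans (cong₂ _+_ (count-partition P? (R? x) xs) (inversions-split xs))
                        (regroup a b i j k)
      where
      open Summands x xs
      regroup : ∀ a b i j k → (a + b) + (j + (i + k)) ≡ (b + j) + (i + (a + k))
      regroup = solve-∀

    backLinks : List A → List A → ℕ
    backLinks pre [] = 0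
    backLinks pre (x ∷ xs) with P? x
    ... | yes _ = backLinks pre xs
    ... | no _  = count (λ v → R? v x) pre + backLinks pre xs

    private
      module Links (x y : A) (pre ys : List A) where
        a = count (λ v → R? v y) pre
        B = backLinks pre ys
        k = count (R? x) (filter (∁? P?) ys)

    backLinks-[] : ∀ xs → backLinks [] xs ≡ 0
    backLinks-[] [] = refl
    backLinks-[] (x ∷ xs) with P? x
    ... | yes _ = backLinks-[] xs
    ... | no _  = backLinks-[] xs

    backLinks-∷ : ∀ x pre xs →
      backLinks (x ∷ pre) xs ≡ backLinks pre xs + count (R? x) (filter (∁? P?) xs)
    backLinks-∷ x pre [] = refl
    backLinks-∷ x pre (y ∷ ys) with P? y
    ... | yes _ = backLinks-∷ x pre ys
    ... | no _ with R? x y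
    ...   | yes _ = trans (cong (λ m → suc (a + m)) (backLinks-∷ x pre ys)) (regroup a B k)
      where
      open Links x y pre ys
      regroup : ∀ a B k → suc (a + (B + k)) ≡ a + B + suc k
      regroup = solve-∀
    ...   | no _  = trans (cong (a +_) (backLinks-∷ x pre ys)) (sym (+-assoc a B k))
      where open Links x y pre ys

  module _ {S c} (c-chain : IsChain c) (c⊆S : All (_∈ S) c) (c-longest : Longest S c) where

    outsider-links< : ∀ {u} pre post → u ∈ S → u ∉ c → pre ++ post ↭ c →
                      count (λ v → R? v u) pre + count (R? u) post < length c
    outsider-links< {u} pre post u∈S u∉c split
      with count (λ v → R? v u) pre + count (R? u) post <? length c
    ... | yes links< = links<
    ... | no links≮ =
      contradiction (c-longest (insert u c) (insert-chain c-chain u∉c u~c) insert⊆S) longer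
      where
      |pre++post|≤links =
        ≤-trans (≤-reflexive (trans (sym (length-++ pre)) (↭-length split))) (≮⇒≥ links≮)
      all-linked =
        +-tight (length-filter (λ v → R? v u) pre) (length-filter (R? u) post) |pre++post|≤links
      pre→u : All (λ v → R v u) pre
      pre→u = length≤count⇒All (λ v → R? v u) pre (proj₁ all-linked)
      u→post : All (R u) post
      u→post = length≤count⇒All (R? u) post (proj₂ all-linked)
      u~c : All (Comparable u) c
      u~c = All.tabulate λ v∈c →
        [ inj₂ ∘ All.lookup pre→u , inj₁ ∘ All.lookup u→post ]′
        (∈-++⁻ pre (∈-resp-↭ (↭-sym split) v∈c))
      insert⊆S : All (_∈ S) (insert u c)
      insert⊆S = All-resp-↭ (↭-sym (insert-↭ u c)) (u∈S ∷ c⊆S)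
      longer : ¬ length (insert u c) ≤ length c
      longer = <-irrefl refl ∘ subst (_≤ length c) (↭-length (insert-↭ u c))

    private
      in-c? : Decidable (_∈ c)
      in-c? = _∈? c

    -- pre holds the vertices of c already passed, so backLinks supplies the links of each
    -- later outsider u from the left, and outsider-links< bounds all links of u at once.
    cross-bound-from : ∀ pre xs → pre ++ filter in-c? xs ↭ c → All (_∈ S) xs →
      backLinks in-c? pre xs + cross in-c? xs + count (∁? in-c?) xs ≤ length c * count (∁? in-c?) xs
    cross-bound-from pre [] _ _ = z≤n
    cross-bound-from pre (x ∷ xs) split (x∈S ∷ xs⊆S) with x ∈? c
    ... | yes _ = begin
      B + (b + C) + N                      ≡⟨ cong (_+ N) (sym (+-assoc B b C)) ⟩
      B + b + C + N                        ≡⟨ cong (λ m → m + C + N) (sym (backLinks-∷ in-c? x pre xs)) ⟩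
      backLinks in-c? (x ∷ pre) xs + C + N ≤⟨ cross-bound-from (x ∷ pre) xs split′ xs⊆S ⟩
      length c * N                         ∎
      where
      open ≤-Reasoning
      b = count (R? x) (filter (∁? in-c?) xs)
      B = backLinks in-c? pre xs
      C = cross in-c? xs
      N = count (∁? in-c?) xs
      split′ : (x ∷ pre) ++ filter in-c? xs ↭ c
      split′ = ↭-trans (↭-sym (shift x pre (filter in-c? xs))) split
    ... | no x∉c = begin
      (a + B) + (b + C) + suc N   ≡⟨ regroup a b B C N ⟩
      suc (a + b) + (B + C + N)   ≤⟨ +-mono-≤ (outsider-links< pre (filter in-c? xs) x∈S x∉c split)
                                              (cross-bound-from pre xs split xs⊆S) ⟩
      length c + length c * N     ≡⟨ sym (*-suc (length c) N) ⟩
      length c * suc N            ∎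
      where
      open ≤-Reasoning
      a = count (λ v → R? v x) pre
      b = count (R? x) (filter in-c? xs)
      B = backLinks in-c? pre xs
      C = cross in-c? xs
      N = count (∁? in-c?) xs
      regroup : ∀ a b B C N → (a + B) + (b + C) + suc N ≡ suc (a + b) + (B + C + N)
      regroup = solve-∀

    cross-bound : ∀ xs → filter in-c? xs ↭ c → All (_∈ S) xs →
                  cross in-c? xs + count (∁? in-c?) xs ≤ length c * count (∁? in-c?) xs
    cross-bound xs split xs⊆S =
      subst (λ B → B + cross in-c? xs + count (∁? in-c?) xs ≤ length c * count (∁? in-c?) xs)
            (backLinks-[] in-c? xs) (cross-bound-from [] xs split xs⊆S)

  words : List A → ℕ → List (List A)
  words S zero    = [ [] ]
  words S (suc k) = [] ∷ concatMap (λ x → map (x ∷_) (words S k)) S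

  ∈-words⁺ : ∀ S k {c} → All (_∈ S) c → length c ≤ k → c ∈ words S k
  ∈-words⁺ S zero    {[]} _ _ = here refl
  ∈-words⁺ S (suc k) {[]} _ _ = here refl
  ∈-words⁺ S (suc k) {x ∷ c} (x∈S ∷ c⊆S) (s≤s len) =
    there (∈-concatMap⁺ (λ y → map (y ∷_) (words S k))
                        (Any.map (λ { refl → ∈-map⁺ (x ∷_) (∈-words⁺ S k c⊆S len) }) x∈S))

  ∈-words⁻ : ∀ S k {c} → c ∈ words S k → All (_∈ S) c
  ∈-words⁻ S zero    (here refl) = []
  ∈-words⁻ S (suc k) (here refl) = []
  ∈-words⁻ S (suc k) (there c∈)
    with find (∈-concatMap⁻ (λ x → map (x ∷_) (words S k)) {xs = S} c∈)
  ... | x , x∈S , c∈x∷words with ∈-map⁻ (x ∷_) c∈x∷words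
  ...   | c′ , c′∈words , refl = x∈S ∷ ∈-words⁻ S k c′∈words

  IsChain? : Decidable IsChain
  IsChain? c = unique? c ×-dec linked? (λ u v → ¬? (u ≟ v) ×-dec R? u v) c

  longest-chain : ∀ {s} S → s ∈ S →
    Σ[ c ∈ List A ] IsChain c × All (_∈ S) c × Longest S c × 0 < length c
  longest-chain {s} S s∈S =
    c , proj₁ c-in-S , proj₂ c-in-S , c-longest , f[⊥]≤f[argmax] {f = length} [ s ] candidates
    where
    candidates = filter IsChain? (words S (length S))
    c = argmax length [ s ] candidates
    candidate : ∀ {c′} → IsChain c′ → All (_∈ S) c′ → c′ ∈ candidates
    candidate ch c′⊆S = ∈-filter⁺ IsChain? c′∈words ch
      where
      c′∈words =
        ∈-words⁺ S (length S) c′⊆S (unique-⊆⇒length≤ (proj₁ ch) (All.lookup c′⊆S))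
    c-in-S : IsChain c × All (_∈ S) c
    c-in-S = argmax-all length ((([] ∷ []) , [-]) , s∈S ∷ [])
      (All.tabulate λ c′∈ → let (c′∈words , ch) = ∈-filter⁻ IsChain? {xs = words S (length S)} c′∈
                            in ch , ∈-words⁻ S (length S) c′∈words)
    c-longest : Longest S c
    c-longest c′ ch c′⊆S =
      All.lookup (f[xs]≤f[argmax] {f = length} [ s ] candidates) (candidate ch c′⊆S)

  module SplitOffChain {ws S c S′} (ws-unique : Unique ws) (ws↭S : ws ↭ S)
                       (c-chain : IsChain c) (c-longest : Longest S c) (S↭c++S′ : S ↭ c ++ S′) where

    inside outside : List A
    inside  = filter (_∈? c) ws
    outside = filter (∁? (_∈? c)) ws

    private
      ws↭c++S′ : ws ↭ c ++ S′
      ws↭c++S′ = ↭-trans ws↭S S↭c++S′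

      c⊆ws : c ⊆ ws
      c⊆ws = ∈-resp-↭ (↭-sym ws↭c++S′) ∘ ∈-++⁺ˡ

      S′∉c : All (_∉ c) S′
      S′∉c = All.tabulate λ v∈S′ v∈c →
        Unique-++⇒disjoint c (Unique-resp-↭ ws↭c++S′ ws-unique) v∈c v∈S′

    inside-unique : Unique inside
    inside-unique = UniqueProperties.filter⁺ (_∈? c) ws-unique

    outside-unique : Unique outside
    outside-unique = UniqueProperties.filter⁺ (∁? (_∈? c)) ws-unique

    inside↭c : inside ↭ c
    inside↭c = filter-∈-↭ _≟_ ws-unique (proj₁ c-chain) c⊆ws

    length-inside : length inside ≡ length c
    length-inside = ↭-length inside↭c

    outside↭S′ : outside ↭ S′
    outside↭S′ = ↭-trans (filter-↭ (∁? (_∈? c)) ws↭c++S′) (↭-reflexive (begin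
      filter (∁? (_∈? c)) (c ++ S′)                    ≡⟨ filter-++ (∁? (_∈? c)) c S′ ⟩
      filter (∁? (_∈? c)) c ++ filter (∁? (_∈? c)) S′  ≡⟨ cong₂ _++_ none-of-c all-of-S′ ⟩
      S′                                               ∎))
      where
      open ≡-Reasoning
      none-of-c = filter-none (∁? (_∈? c)) (All.tabulate λ v∈c v∉c → v∉c v∈c)
      all-of-S′ = filter-all (∁? (_∈? c)) S′∉c

    inversions-inside≤ : inversions inside ≤ pairs (length c)
    inversions-inside≤ =
      subst (λ ℓ → inversions inside ≤ pairs ℓ) length-inside (inversions≤pairs inside)

    cross≤ : 0 < length c → ∀ {N} → length S′ ≡ N → cross (_∈? c) ws ≤ pred (length c) * N
    cross≤ c≢[] refl = m+n≤o*n⇒m≤pred[o]*n c≢[]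
      (subst (λ N → cross (_∈? c) ws + N ≤ length c * N) (↭-length outside↭S′)
             (cross-bound c-chain c⊆S c-longest ws inside↭c (All.tabulate (∈-resp-↭ ws↭S))))
      where
      c⊆S : All (_∈ S) c
      c⊆S = All.tabulate (∈-resp-↭ (↭-sym S↭c++S′) ∘ ∈-++⁺ˡ)

flatten : {A : Set} → List (List A) → List A
flatten cs = concat (reverse cs)

flatten-∷ : {A : Set} (c : List A) (cs : List (List A)) → flatten (c ∷ cs) ≡ flatten cs ++ c
flatten-∷ c cs = begin
  concat (reverse (c ∷ cs))         ≡⟨ cong concat (unfold-reverse c cs) ⟩
  concat (reverse cs ++ [ c ])      ≡⟨ sym (concat-++ (reverse cs) [ c ]) ⟩
  concat (reverse cs) ++ (c ++ [])  ≡⟨ cong (concat (reverse cs) ++_) (++-identityʳ c) ⟩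
  concat (reverse cs) ++ c          ∎
  where open ≡-Reasoning

-- (k + 1) + ⋯ + (k + ℓ − 1): the maj′ of a chain of length ℓ at positions k + 1, …, k + ℓ.
chainMaj : ℕ → ℕ → ℕ
chainMaj k ℓ = pairs ℓ + pred ℓ * k

chainBound : {A : Set} → List (List A) → ℕ
chainBound []       = 0
chainBound (c ∷ cs) = chainBound cs + chainMaj (length (flatten cs)) (length c)

module Decompositions {n} {α : Fin n → ℕ} (U : Rel n) where

  _≟V_ : DecidableEquality (Vertex α)
  _≟V_ = ≡-dec _≟F_ _≟F_

  R? : Decidable₂ (λ (u v : Vertex α) → U (val u) (val v) ≡ true)
  R? u v = U (val u) (val v) Bool.≟ true

  open Chains _≟V_ R? public
  open import Data.List.Membership.DecPropositional _≟V_ using (_∈?_)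

  MaxChainDecomp⇒↭ : ∀ {S : List (Vertex α)} {cs} → MaxChainDecomp U S cs → S ↭ flatten cs
  MaxChainDecomp⇒↭ done = ↭-refl
  MaxChainDecomp⇒↭ {cs = c ∷ cs} (step _ _ _ S↭c++S′ rest) =
    ↭-trans S↭c++S′ (↭-trans (++⁺ˡ c (MaxChainDecomp⇒↭ rest))
                    (↭-trans (++-comm c (flatten cs)) (↭-reflexive (sym (flatten-∷ c cs)))))

  inversions≤chainBound : ∀ {S : List (Vertex α)} {cs} → MaxChainDecomp U S cs →
    ∀ {ws} → Unique ws → ws ↭ S → inversions ws ≤ chainBound cs
  inversions≤chainBound done _ ws↭[] rewrite ↭-empty-inv ws↭[] = z≤n
  inversions≤chainBound {cs = c ∷ cs} (step c≢[] chain longest S↭c++S′ rest) {ws} ws-unique ws↭S =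
    begin
      inversions ws                                                ≡⟨ inversions-split (_∈? c) ws ⟩
      inversions outside + (inversions inside + cross (_∈? c) ws)
        ≤⟨ +-mono-≤ (inversions≤chainBound rest outside-unique outside↭S′)
                    (+-mono-≤ inversions-inside≤ cross≤′) ⟩
      chainBound (c ∷ cs)                                          ∎
    where
    open ≤-Reasoning
    open SplitOffChain ws-unique ws↭S chain longest S↭c++S′
    cross≤′ = cross≤ c≢[] (↭-length (MaxChainDecomp⇒↭ rest))

  transitive-decomposition : ∀ {S : List (Vertex α)} {cs} → MaxChainDecomp U S cs →
    ∀ {ws} → Unique ws → ws ↭ S → chainBound cs ≤ inversions ws →
    Σ[ cs* ∈ List (List (Vertex α)) ] MaxChainDecomp U S cs* × All (TransitiveChain U) cs*
  transitive-decomposition done _ _ _ = [] , done , []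
  transitive-decomposition {cs = c ∷ cs} (step c≢[] chain longest S↭c++S′ rest) {ws} ws-unique ws↭S tight =
    let (outside-tight , inner-tight) =
          +-tight (inversions≤chainBound rest outside-unique outside↭S′)
                  (+-mono-≤ inversions-inside≤ cross≤′)
                  (≤-trans tight (≤-reflexive (inversions-split (_∈? c) ws)))
        (inside-tight , _) = +-tight inversions-inside≤ cross≤′ inner-tight
        inside-transitive = pairs≤inversions⇒AllPairs inside
          (subst (λ ℓ → pairs ℓ ≤ inversions inside) (sym length-inside) inside-tight)
        (cs* , decomposition* , transitive*) =
          transitive-decomposition rest outside-unique outside↭S′ outside-tight
    in inside ∷ cs* ,
       step (subst (0 <_) (sym length-inside) c≢[])
            (inside-unique , AllPairs⇒Linked (AllPairs.zip (inside-unique , inside-transitive)))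
            (λ c′ chain′ c′⊆S →
               subst (length c′ ≤_) (sym length-inside) (longest c′ chain′ c′⊆S))
            (↭-trans S↭c++S′ (++⁺ʳ _ (↭-sym inside↭c)))
            decomposition* ,
       inside-transitive ∷ transitive*
    where
    open SplitOffChain ws-unique ws↭S chain longest S↭c++S′
    cross≤′ = cross≤ c≢[] (↭-length (MaxChainDecomp⇒↭ rest))

  maxChainDecomp-exists : ∀ (S : List (Vertex α)) → Unique S →
    Σ[ cs ∈ List (List (Vertex α)) ] MaxChainDecomp U S cs
  maxChainDecomp-exists S = decompose (length S) S ≤-refl
    where
    decompose : ∀ k (S : List (Vertex α)) → length S ≤ k → Unique S →
      Σ[ cs ∈ List (List (Vertex α)) ] MaxChainDecomp U S cs
    decompose _ [] _ _ = [] , done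
    decompose (suc k) S@(s ∷ _) |S|≤ S-unique = split-off (longest-chain S (here refl))
      where
      split-off : Σ[ c ∈ List (Vertex α) ] IsChain c × All (_∈ S) c × Longest S c × 0 < length c →
                  Σ[ cs ∈ List (List (Vertex α)) ] MaxChainDecomp U S cs
      split-off (c , chain , c⊆S , longest , c≢[]) =
        let (cs , decomposition) =
              decompose k S′ |S′|≤k (UniqueProperties.filter⁺ (∁? (_∈? c)) S-unique)
        in c ∷ cs , step c≢[] chain longest S↭c++S′ decomposition
        where
        S′ : List (Vertex α)
        S′ = filter (∁? (_∈? c)) S
        S↭c++S′ : S ↭ c ++ S′
        S↭c++S′ = ↭-trans (filter-partition-↭ (_∈? c) S)
                          (++⁺ʳ S′ (filter-∈-↭ _≟V_ S-unique (proj₁ chain) (All.lookup c⊆S)))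
        |S′|≤k : length S′ ≤ k
        |S′|≤k = s≤s⁻¹ (begin
          suc (length S′)      ≤⟨ +-monoˡ-≤ (length S′) c≢[] ⟩
          length c + length S′ ≡⟨ sym (length-++ c) ⟩
          length (c ++ S′)     ≡⟨ sym (↭-length S↭c++S′) ⟩
          length S             ≤⟨ |S|≤ ⟩
          suc k                ∎)
          where open ≤-Reasoning

  majFrom-++ : ∀ k xs ys → majFrom U k xs + majFrom U (k + length xs) ys ≤ majFrom U k (xs ++ ys)
  majFrom-++ k [] ys rewrite +-identityʳ k = ≤-refl
  majFrom-++ k (x ∷ []) [] = z≤n
  majFrom-++ k (x ∷ []) (y ∷ ys) rewrite +-comm k 1 = m≤n+m _ _
  majFrom-++ k (x ∷ x′ ∷ xs) ys = begin
    (descent + rest) + majFrom U (k + suc (suc (length xs))) ys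
      ≡⟨ +-assoc descent rest _ ⟩
    descent + (rest + majFrom U (k + suc (suc (length xs))) ys)
      ≡⟨ cong (λ m → descent + (rest + majFrom U m ys)) (+-suc k _) ⟩
    descent + (rest + majFrom U (suc k + suc (length xs)) ys)
      ≤⟨ +-monoʳ-≤ descent (majFrom-++ (suc k) (x′ ∷ xs) ys) ⟩
    descent + majFrom U (suc k) (x′ ∷ xs ++ ys)
      ∎
    where
    open ≤-Reasoning
    descent = if U x x′ then k else 0
    rest = majFrom U (suc k) (x′ ∷ xs)

  majFrom-chain : ∀ k w → Linked (λ x y → U x y ≡ true) w →
                  majFrom U (suc k) w ≡ chainMaj k (length w)
  majFrom-chain k []          _ = refl
  majFrom-chain k (x ∷ [])    _ = refl
  majFrom-chain k (x ∷ y ∷ w) (xy ∷ linked) rewrite xy =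
    trans (cong (suc k +_) (majFrom-chain (suc k) (y ∷ w) linked))
          (shift-start k (length w) (pairs (length w)))
    where
    shift-start : ∀ k l p → suc k + ((l + p) + l * suc k) ≡ (suc l + (l + p)) + suc l * k
    shift-start = solve-∀

  chainBound≤maj′ : ∀ {S : List (Vertex α)} {cs} → MaxChainDecomp U S cs →
                    chainBound cs ≤ maj′ U (chainWord cs)
  chainBound≤maj′ done = z≤n
  chainBound≤maj′ {cs = c ∷ cs} (step _ (_ , linked) _ _ rest) = begin
    chainBound cs + chainMaj (length (flatten cs)) (length c)
      ≤⟨ +-monoˡ-≤ _ (chainBound≤maj′ rest) ⟩
    majFrom U 1 earlier + chainMaj (length (flatten cs)) (length c)
      ≡⟨ cong (majFrom U 1 earlier +_) (sym last-chain) ⟩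
    majFrom U 1 earlier + majFrom U (1 + length earlier) (map val c)
      ≤⟨ majFrom-++ 1 earlier (map val c) ⟩
    majFrom U 1 (earlier ++ map val c)
      ≡⟨ cong (majFrom U 1) (sym (trans (cong (map val) (flatten-∷ c cs)) (map-++ val _ c))) ⟩
    maj′ U (chainWord (c ∷ cs))
      ∎
    where
    open ≤-Reasoning
    earlier = chainWord cs
    last-chain : majFrom U (suc (length earlier)) (map val c) ≡ chainMaj (length (flatten cs)) (length c)
    last-chain = trans (majFrom-chain (length earlier) (map val c)
                                      (LinkedProperties.map⁺ (Linked.map proj₂ linked)))
                       (cong₂ chainMaj (length-map val (flatten cs)) (length-map val c))

  inv′-map-val : ∀ ws → inv′ U (map val ws) ≡ inversions ws
  inv′-map-val []       = refl
  inv′-map-val (v ∷ ws) =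
    cong₂ _+_ (count-map (λ y → U (val v) y Bool.≟ true) val ws) (inv′-map-val ws)

module _ {n} (α : Fin n → ℕ) where

  private
    copies : (i : Fin n) → List (Vertex α)
    copies i = map (i ,_) (allFin (α i))

    copies-unique : ∀ i → Unique (copies i)
    copies-unique i = UniqueProperties.map⁺ (λ { refl → refl }) (UniqueProperties.allFin⁺ (α i))

  allVertices-unique : Unique (allVertices α)
  allVertices-unique =
    UniqueProperties.concat⁺ (AllProperties.map⁺ (All.tabulate λ {i} _ → copies-unique i))
                             (AllPairsProperties.map⁺ (AllPairs.map disjoint (UniqueProperties.allFin⁺ n)))
    where
    disjoint : ∀ {i j} → i ≢ j → ∀ {v} → ¬ (v ∈ copies i × v ∈ copies j)
    disjoint {i} {j} i≢j (v∈i , v∈j) with ∈-map⁻ (i ,_) v∈i | ∈-map⁻ (j ,_) v∈j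
    ... | _ , _ , refl | _ , _ , v≡ = i≢j (cong proj₁ v≡)

  ∈-allVertices : ∀ v → v ∈ allVertices α
  ∈-allVertices (i , k) =
    ∈-concatMap⁺ copies (Any.map (λ { refl → ∈-map⁺ (i ,_) (∈-allFin k) }) (∈-allFin i))

  count-allVertices : ∀ i → count (λ v → val v ≟F i) (allVertices α) ≡ α i
  count-allVertices i = begin
    count (λ v → val v ≟F i) (allVertices α) ≡⟨ ↭-length copies-of-i ⟩
    length (copies i)                        ≡⟨ length-map {B = Vertex α} (i ,_) (allFin (α i)) ⟩
    length (allFin (α i))                    ≡⟨ length-tabulate {A = Fin (α i)} id ⟩
    α i                                      ∎
    where
    open ≡-Reasoning
    sound : filter (λ v → val v ≟F i) (allVertices α) ⊆ copies i
    sound v∈ with ∈-filter⁻ (λ v → val v ≟F i) {xs = allVertices α} v∈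
    ... | _ , refl = ∈-map⁺ (i ,_) (∈-allFin _)
    complete : copies i ⊆ filter (λ v → val v ≟F i) (allVertices α)
    complete v∈ with ∈-map⁻ (i ,_) v∈
    ... | k , _ , refl = ∈-filter⁺ (λ v → val v ≟F i) (∈-allVertices (i , k)) refl
    copies-of-i : filter (λ v → val v ≟F i) (allVertices α) ↭ copies i
    copies-of-i =
      unique-⊆⊇⇒↭ (UniqueProperties.filter⁺ _ allVertices-unique) (copies-unique i) sound complete

  InR-↭ : ∀ {ws} → ws ↭ allVertices α → InR α (map val ws)
  InR-↭ {ws} ws↭ i = begin
    occ i (map val ws)                       ≡⟨ count-map (_≟F i) val ws ⟩
    count (λ v → val v ≟F i) ws              ≡⟨ count-resp-↭ (λ v → val v ≟F i) ws↭ ⟩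
    count (λ v → val v ≟F i) (allVertices α) ≡⟨ count-allVertices i ⟩
    α i                                      ∎
    where open ≡-Reasoning

lemma3p4 : (n : ℕ) (α : Fin n → ℕ) (U : Rel n) →
    Equidistributed α U →
    Σ (List (List (Vertex α))) (λ cs →
      MaxChainDecomp U (allVertices α) cs ×
      InR α (chainWord cs) ×
      All (TransitiveChain U) cs)
lemma3p4 n α U equidistributed =
  let (cs , decomposition) = maxChainDecomp-exists (allVertices α) (allVertices-unique α)
      chainWord∈R = InR-↭ α (↭-sym (MaxChainDecomp⇒↭ decomposition))
      (w , w∈R , inv′≡maj′) =
        Inverse.to (equidistributed (maj′ U (chainWord cs))) (chainWord cs , chainWord∈R , refl)
      (ws , w≡ , flat↭ws) = ↭-map-inv val
        (occurrences-≡⇒↭ _≟F_ (chainWord cs) {w} λ i → trans (chainWord∈R i) (sym (w∈R i)))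
      ws↭ = ↭-trans (↭-sym flat↭ws) (↭-sym (MaxChainDecomp⇒↭ decomposition))
      ws-unique = Unique-resp-↭ (↭-sym ws↭) (allVertices-unique α)
      bound = ≤-trans (chainBound≤maj′ decomposition)
        (≤-reflexive (trans (sym inv′≡maj′) (trans (cong (inv′ U) w≡) (inv′-map-val ws))))
      (cs* , decomposition* , transitive*) = transitive-decomposition decomposition ws-unique ws↭ bound
  in cs* , decomposition* , InR-↭ α (↭-sym (MaxChainDecomp⇒↭ decomposition*)) , transitive*
  where open Decompositions {α = α} U
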